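{- Let $\mathbb F$ be a finite field. If an unrestricted arithmetic circuit over $\mathbb F$ with $n$ inputs and $m$ outputs encodes (computes) a superconcentrator-induced code $C:\mathbb F^n\to\mathbb F^m$, then its underlying directed acyclic graph is an $(n,m)$-superconcentrator.
   Context: An unrestricted arithmetic circuit over $\mathbb F$ is a directed acyclic graph with $n$ input vertices $x_1,\dots,x_n\in\mathbb F$ and $m$ designated output vertices $y_1,\dots,y_m$, in which every non-input vertex (gate) of in-degree $s$ computes an arbitrary function $\mathbb F^s\to\mathbb F$ of its in-neighbours' values (unbounded fan-in and fan-out). A map $C:\mathbb F^n\to\mathbb F^m$ is a superconcentrator-induced code if $\mathrm{dist}(C(x),C(y))\ge m-\mathrm{dist}(x,y)+1$ for all distinct $x,y$, where $\mathrm{dist}$ is Hamming distance. A directed acyclic graph with $n$ inputs and $m$ outputs is an $(n,m)$-superconcentrator if for every set $X$ of inputs and set $Y$ of outputs with $|X|=|Y|$, the maximum number of vertex-disjoint paths from $X$ to $Y$ equals $|X|$. -}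

module Defs where

open import Data.Nat using (ℕ; zero; suc; _≤_)
import Data.Nat as ℕ
open import Data.Fin using (Fin)
import Data.Fin as Fin
open import Data.Fin.Subset using (Subset; _∈_; ∣_∣)
open import Data.Bool using (Bool; true; false)
open import Data.List using (List; []; _∷_)
import Data.List.Membership.Propositional as LM
open import Data.Product using (∃; Σ; _×_; _,_)
open import Data.Empty using (⊥)
open import Relation.Nullary using (¬_; yes; no)
open import Relation.Binary.Definitions using (DecidableEquality)
open import Relation.Binary.PropositionalEquality using (_≡_; _≢_; cong; sym; trans)
open import Function.Bundles using (_↔_; Inverse)
open import Function.Definitions using (Injective)
open import Algebra.Structures using (IsCommutativeRing)

record FiniteField : Set₁ where
  infixl 6 _+_
  infixl 7 _*_
  field
    Carrier : Set
    _+_ _*_ : Carrier → Carrier → Carrier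
    -_      : Carrier → Carrier
    0# 1#   : Carrier
    isCommutativeRing : IsCommutativeRing _≡_ _+_ _*_ -_ 0# 1#
    0≢1     : 0# ≢ 1#
    inverse : ∀ x → x ≢ 0# → ∃ λ y → x * y ≡ 1#
    size    : ℕ
    enum    : Carrier ↔ Fin size

  _≟_ : DecidableEquality Carrier
  x ≟ y with Inverse.to enum x Fin.≟ Inverse.to enum y
  ... | yes p = yes (trans (sym (Inverse.strictlyInverseʳ enum x))
                     (trans (cong (Inverse.from enum) p) (Inverse.strictlyInverseʳ enum y)))
  ... | no ¬p = no (λ x≡y → ¬p (cong (Inverse.to enum) x≡y))

module _ {A : Set} (_≟_ : DecidableEquality A) where

  dist : ∀ {k} → (Fin k → A) → (Fin k → A) → ℕ
  dist {zero}  x y = 0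
  dist {suc k} x y with x Fin.zero ≟ y Fin.zero
  ... | yes _ = dist (λ i → x (Fin.suc i)) (λ i → y (Fin.suc i))
  ... | no  _ = suc (dist (λ i → x (Fin.suc i)) (λ i → y (Fin.suc i)))

-- Superconcentrator-induced codes C : F^n → F^m:
--   dist(C x, C y) ≥ m − dist(x, y) + 1  for all x ≠ y,
-- written without truncated subtraction as
--   m + 1 ≤ dist(C x, C y) + dist(x, y).

module _ (𝔽 : FiniteField) where
  open FiniteField 𝔽 using (Carrier; _≟_)

  SCInducedCode : ∀ {n m} → ((Fin n → Carrier) → (Fin m → Carrier)) → Set
  SCInducedCode {n} {m} C =
    ∀ (x y : Fin n → Carrier) → x ≢ y →
      suc m ≤ dist _≟_ (C x) (C y) ℕ.+ dist _≟_ x y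

module _ {N : ℕ} (adj : Fin N → Fin N → Bool) where

  data Path : Fin N → Fin N → Set where
    [_] : ∀ v → Path v v
    _∷⟨_⟩_ : ∀ u {v w} → adj u v ≡ true → Path v w → Path u w

  vertices : ∀ {u w} → Path u w → List (Fin N)
  vertices [ v ] = v ∷ []
  vertices (u ∷⟨ _ ⟩ p) = u ∷ vertices p

  Acyclic : Set
  Acyclic = ∀ u v → adj u v ≡ true → Path v u → ⊥

record DAG (n m : ℕ) : Set where
  field
    N        : ℕ
    adj      : Fin N → Fin N → Bool
    acyclic  : Acyclic adj
    inp      : Fin n → Fin N
    inp-inj  : Injective _≡_ _≡_ inp
    inp-src  : ∀ a u → adj u (inp a) ≡ false
    out      : Fin m → Fin N
    out-inj  : Injective _≡_ _≡_ out

module _ {n m : ℕ} (G : DAG n m) where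
  open DAG G

  record PathXY (X : Subset n) (Y : Subset m) : Set where
    field
      a    : Fin n
      a∈X  : a ∈ X
      b    : Fin m
      b∈Y  : b ∈ Y
      path : Path adj (inp a) (out b)

  pathVerts : ∀ {X Y} → PathXY X Y → List (Fin N)
  pathVerts P = vertices adj (PathXY.path P)

  DisjointPaths : Subset n → Subset m → ℕ → Set
  DisjointPaths X Y t =
    Σ (Fin t → PathXY X Y) λ P →
      ∀ i j → i ≢ j → ∀ v →
        v LM.∈ pathVerts (P i) → v LM.∈ pathVerts (P j) → ⊥

  -- (n,m)-superconcentrator: for all X ⊆ inputs, Y ⊆ outputs with
  -- |X| = |Y|, the maximum number of vertex-disjoint X–Y paths is |X|;
  -- since it is trivially ≤ |X|, this says |X| such paths exist.
  IsSuperconcentrator : Set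
  IsSuperconcentrator =
    ∀ (X : Subset n) (Y : Subset m) → ∣ X ∣ ≡ ∣ Y ∣ → DisjointPaths X Y ∣ X ∣

-- Unrestricted arithmetic circuits over a finite field: a DAG together
-- with, at every vertex v, a gate function whose value depends only on
-- the values at the in-neighbours of v (i.e. an arbitrary function of
-- the in-neighbours' values; unbounded fan-in/fan-out).  Gate functions
-- are only used at non-input vertices.

record Circuit (𝔽 : FiniteField) (n m : ℕ) : Set where
  open FiniteField 𝔽 using (Carrier)
  field
    graph : DAG n m
  open DAG graph
  field
    gate       : Fin N → (Fin N → Carrier) → Carrier
    gate-local : ∀ v (f g : Fin N → Carrier) →
                   (∀ u → adj u v ≡ true → f u ≡ g u) → gate v f ≡ gate v g

module _ {𝔽 : FiniteField} {n m : ℕ} (Φ : Circuit 𝔽 n m) where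
  open FiniteField 𝔽 using (Carrier)
  open Circuit Φ
  open DAG graph

  Consistent : (Fin n → Carrier) → (Fin N → Carrier) → Set
  Consistent x val =
    (∀ a → val (inp a) ≡ x a) ×
    (∀ v → (∀ a → inp a ≢ v) → val v ≡ gate v val)

  Computes : ((Fin n → Carrier) → (Fin m → Carrier)) → Set
  Computes C = ∀ x val → Consistent x val → ∀ j → val (out j) ≡ C x j

{-# OPTIONS --safe #-}
-- Fix inputs X and outputs Y with |X| = |Y|.  Menger's theorem (Göring's induction on the
-- edges) yields either |X| vertex-disjoint X–Y paths or a set S of fewer than |X| vertices
-- meeting every X–Y path.  In the second case freeze the inputs outside X to 0: the values the
-- circuit computes on S then determine its outputs on Y, and as |F|^|S| < |F|^|X| two distinct
-- inputs x ≠ y supported on X agree on S.  So C x and C y agree on Y, and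
-- dist (C x) (C y) + dist x y ≤ (m − |Y|) + |X| = m, contradicting the code property.
module Submission where

open import Defs
open import Level using (0ℓ)
open import Data.Nat using (ℕ; zero; suc; _≤_; _<_; z≤n; s≤s; _+_; _^_; _<?_; _≤?_)
import Data.Nat.Properties as ℕ
open import Data.Bool using (Bool; true)
import Data.Bool as Bool
open import Data.Fin as Fin using (Fin; zero; suc; inject≤; funToFin; finToFun; combine)
import Data.Fin.Properties as Fin
open import Data.Fin.Subset using (Subset; inside; outside; ∣_∣) renaming (_∈_ to _∈ₛ_; _∉_ to _∉ₛ_)
import Data.Fin.Subset.Properties as Subset
open import Data.Vec using (_∷_; []; here; there)
open import Data.List using (List; []; _∷_; length; lookup; filter; allFin; cartesianProduct)
open import Data.List.Membership.Propositional using (_∈_; _∉_)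
open import Data.List.Membership.Propositional.Properties
  using (∈-lookup; ∈-filter⁺; ∈-filter⁻; ∈-allFin; ∈-cartesianProduct⁺)
open import Data.List.Relation.Binary.Subset.Propositional using (_⊆_)
open import Data.List.Relation.Binary.Subset.Propositional.Properties using (∷⁺ʳ)
import Data.List.Relation.Unary.All as All
open import Data.List.Relation.Unary.All using ([]; tabulate)
open import Data.List.Relation.Unary.Any as Any using (here; there; index)
open import Data.List.Relation.Unary.Any.Properties using (lookup-index)
open import Data.List.Relation.Unary.AllPairs using ([]; _∷_)
open import Data.List.Relation.Unary.Unique.Propositional using (Unique)
import Data.List.Relation.Unary.Unique.Propositional.Properties as Unique
open import Data.Product using (Σ; ∃; ∃₂; _×_; _,_; proj₁; proj₂)
open import Data.Sum using (_⊎_; inj₁; inj₂)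
open import Data.Unit using (⊤; tt)
open import Data.Empty using (⊥; ⊥-elim)
open import Relation.Nullary using (¬_; Dec; yes; no)
open import Relation.Nullary.Decidable using (_×-dec_)
open import Relation.Unary using (Pred; Decidable)
open import Relation.Binary.Definitions using (DecidableEquality)
open import Relation.Binary.PropositionalEquality
  using (_≡_; _≢_; _≗_; refl; sym; trans; cong; cong₂; subst; module ≡-Reasoning)
open import Function using (_∘_; id)
open import Function.Bundles using (_↔_; Inverse; Injection)
open import Function.Properties.Inverse using (↔⇒↣; ↔-sym)
open import Function.Definitions using (Injective)

module _ {A : Set} where

  lookup-injective : ∀ {xs : List A} → Unique xs → Injective _≡_ _≡_ (lookup xs)
  lookup-injective {xs = x ∷ xs} (x∉ ∷ u) {zero}  {zero}  _  = refl
  lookup-injective {xs = x ∷ xs} (x∉ ∷ u) {zero}  {suc j} eq = ⊥-elim (All.lookup x∉ (∈-lookup j) eq)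
  lookup-injective {xs = x ∷ xs} (x∉ ∷ u) {suc i} {zero}  eq = ⊥-elim (All.lookup x∉ (∈-lookup i) (sym eq))
  lookup-injective {xs = x ∷ xs} (x∉ ∷ u) {suc i} {suc j} eq = cong suc (lookup-injective u eq)

  unique⇒distinctMembers : ∀ {k} {xs : List A} → Unique xs → k ≤ length xs →
                           Σ (Fin k → A) λ f → Injective _≡_ _≡_ f × (∀ i → f i ∈ xs)
  unique⇒distinctMembers {xs = xs} u k≤ =
    (λ i → lookup xs (inject≤ i k≤)) ,
    (λ eq → Fin.inject≤-injective k≤ k≤ _ _ (lookup-injective u eq)) ,
    (λ i → ∈-lookup (inject≤ i k≤))

  private
    index-injective : ∀ {k} {xs : List A} {f : Fin k → A} → Injective _≡_ _≡_ f →
                      (f∈ : ∀ i → f i ∈ xs) → Injective _≡_ _≡_ (λ i → index (f∈ i))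
    index-injective {xs = xs} f-inj f∈ {i} {j} eq =
      f-inj (trans (lookup-index (f∈ i)) (trans (cong (lookup xs) eq) (sym (lookup-index (f∈ j)))))

  injection⇒≤length : ∀ {k} {xs : List A} {f : Fin k → A} → Injective _≡_ _≡_ f →
                      (∀ i → f i ∈ xs) → k ≤ length xs
  injection⇒≤length f-inj f∈ = Fin.injective⇒≤ (index-injective f-inj f∈)

  injection-missing⇒<length : ∀ {k} {xs : List A} {f : Fin k → A} {z} → Injective _≡_ _≡_ f →
                              (∀ i → f i ∈ xs) → z ∈ xs → (∀ i → f i ≢ z) → k < length xs
  injection-missing⇒<length {xs = _ ∷ _} f-inj f∈ z∈ f≢z =
    s≤s (Fin.injective⇒≤ λ eq →
      index-injective f-inj f∈ (Fin.punchOut-injective (index≢ _) (index≢ _) eq))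
    where
      index≢ : ∀ i → index z∈ ≢ index (f∈ i)
      index≢ i eq = f≢z i (trans (lookup-index (f∈ i))
                                 (trans (cong (lookup _) (sym eq)) (sym (lookup-index z∈))))

unique⇒length≤ : ∀ {N} {xs : List (Fin N)} → Unique xs → length xs ≤ N
unique⇒length≤ u = Fin.injective⇒≤ (lookup-injective u)

funToFin-cong : ∀ {k q} {f g : Fin k → Fin q} → f ≗ g → funToFin f ≡ funToFin g
funToFin-cong {zero}  _   = refl
funToFin-cong {suc k} f≗g = cong₂ combine (f≗g zero) (funToFin-cong (f≗g ∘ suc))

module _ {A : Set} {q : ℕ} (enum : A ↔ Fin q) where
  open Inverse enum using (to; from)
  open Injection (↔⇒↣ enum) using () renaming (injective to to-injective)
  open Injection (↔⇒↣ (↔-sym enum)) using () renaming (injective to from-injective)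
  open ≡-Reasoning

  distinct⇒1<size : ∀ {x y : A} → x ≢ y → 1 < q
  distinct⇒1<size {x} {y} x≢y = 1<q (to x) (to y) (x≢y ∘ to-injective)
    where
      1<q : ∀ {q} (i j : Fin q) → i ≢ j → 1 < q
      1<q {suc zero}    zero zero i≢j = ⊥-elim (i≢j refl)
      1<q {suc (suc _)} _    _    _   = s≤s (s≤s z≤n)

  private
    decode : ∀ {k} → Fin (q ^ k) → Fin k → A
    decode {k} c = from ∘ finToFun {q} {k} c

    encode : ∀ {t} → (Fin t → A) → Fin (q ^ t)
    encode g = funToFin (to ∘ g)

    decode-injective : ∀ {k} {c c′ : Fin (q ^ k)} → decode {k} c ≗ decode c′ → c ≡ c′
    decode-injective {k} {c} {c′} eq = begin
      c                                ≡⟨ Fin.funToFin-finToFin {k} {q} c ⟨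
      funToFin (finToFun {q} {k} c)  ≡⟨ funToFin-cong {k} {q} (from-injective ∘ eq) ⟩
      funToFin (finToFun {q} {k} c′) ≡⟨ Fin.funToFin-finToFin {k} {q} c′ ⟩
      c′                               ∎

    encode-injective : ∀ {t} {g g′ : Fin t → A} → encode g ≡ encode g′ → g ≗ g′
    encode-injective {t} {g} {g′} eq l = to-injective (begin
      to (g l)                        ≡⟨ Fin.finToFun-funToFin (to ∘ g) l ⟨
      finToFun {q} {t} (encode g) l   ≡⟨ cong (λ c → finToFun {q} {t} c l) eq ⟩
      finToFun {q} {t} (encode g′) l  ≡⟨ Fin.finToFun-funToFin (to ∘ g′) l ⟩
      to (g′ l)                       ∎)

  functions-pigeonhole : 1 < q → ∀ {t k} → t < k → (H : (Fin k → A) → (Fin t → A)) →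
                         ∃₂ λ f g → ¬ (f ≗ g) × H f ≗ H g
  functions-pigeonhole 1<q {t} {k} t<k H
    with i , j , i<j , eq ← Fin.pigeonhole (ℕ.^-monoʳ-< q 1<q t<k) (encode {t} ∘ H ∘ decode {k})
    = decode i , decode j , Fin.<⇒≢ i<j ∘ decode-injective {k} , encode-injective eq

module _ {A : Set} where

  restrict : ∀ {n} (X : Subset n) → (Fin n → A) → Fin ∣ X ∣ → A
  restrict (inside  ∷ X) x zero    = x zero
  restrict (inside  ∷ X) x (suc l) = restrict X (x ∘ suc) l
  restrict (outside ∷ X) x         = restrict X (x ∘ suc)

  extend : ∀ {n} → A → (X : Subset n) → (Fin ∣ X ∣ → A) → Fin n → A
  extend d (inside  ∷ X) f zero    = f zero
  extend d (inside  ∷ X) f (suc a) = extend d X (f ∘ suc) a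
  extend d (outside ∷ X) f zero    = d
  extend d (outside ∷ X) f (suc a) = extend d X f a

  restrict-extend : ∀ {n} d (X : Subset n) f → restrict X (extend d X f) ≗ f
  restrict-extend d (inside  ∷ X) f zero    = refl
  restrict-extend d (inside  ∷ X) f (suc l) = restrict-extend d X (f ∘ suc) l
  restrict-extend d (outside ∷ X) f         = restrict-extend d X f

  extend-∉ : ∀ {n} d (X : Subset n) f {a} → a ∉ₛ X → extend d X f a ≡ d
  extend-∉ d (inside  ∷ X) f {zero}  a∉ = ⊥-elim (a∉ here)
  extend-∉ d (inside  ∷ X) f {suc a} a∉ = extend-∉ d X (f ∘ suc) (a∉ ∘ there)
  extend-∉ d (outside ∷ X) f {zero}  a∉ = refl
  extend-∉ d (outside ∷ X) f {suc a} a∉ = extend-∉ d X f (a∉ ∘ there)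

module _ {A : Set} {k : ℕ} where

  AgreeOn AgreeOutside : Subset k → (Fin k → A) → (Fin k → A) → Set
  AgreeOn      Z u w = ∀ a → a ∈ₛ Z → u a ≡ w a
  AgreeOutside Z u w = ∀ a → a ∉ₛ Z → u a ≡ w a

module _ {A : Set} (_≟_ : DecidableEquality A) where

  agreeOutside⇒dist≤∣∣ : ∀ {k} (Z : Subset k) {u w : Fin k → A} → AgreeOutside Z u w → dist _≟_ u w ≤ ∣ Z ∣
  agreeOutside⇒dist≤∣∣ []            _  = z≤n
  agreeOutside⇒dist≤∣∣ (side ∷ Z) {u} {w} eq
    with ih ← agreeOutside⇒dist≤∣∣ Z (λ a a∉ → eq (suc a) (a∉ ∘ Subset.drop-there))
    with u zero ≟ w zero | side
  ... | yes _  | inside  = ℕ.m≤n⇒m≤1+n ih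
  ... | no  _  | inside  = s≤s ih
  ... | yes _  | outside = ih
  ... | no u≢w | outside = ⊥-elim (u≢w (eq zero λ ()))

  agreeOn⇒dist+∣∣≤ : ∀ {k} (Z : Subset k) {u w : Fin k → A} → AgreeOn Z u w → dist _≟_ u w + ∣ Z ∣ ≤ k
  agreeOn⇒dist+∣∣≤ []         _  = z≤n
  agreeOn⇒dist+∣∣≤ (side ∷ Z) {u} {w} eq
    with ih ← agreeOn⇒dist+∣∣≤ Z (λ a → eq (suc a) ∘ there)
    with u zero ≟ w zero | side
  ... | yes _  | inside  = ℕ.≤-trans (ℕ.≤-reflexive (ℕ.+-suc _ _)) (s≤s ih)
  ... | no u≢w | inside  = ⊥-elim (u≢w (eq zero here))
  ... | yes _  | outside = ℕ.m≤n⇒m≤1+n ih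
  ... | no  _  | outside = s≤s ih

module Menger (N : ℕ) where

  open import Data.List.Membership.DecPropositional (Fin._≟_ {N}) using (_∈?_)

  Vertex : Set
  Vertex = Fin N

  Edge : Set
  Edge = Vertex × Vertex

  VertexSet : Set₁
  VertexSet = Pred Vertex 0ℓ

  private variable
    E E′            : List Edge
    a b u v w x y z : Vertex
    S T U           : List Vertex
    A A′ B B′       : VertexSet

  infixr 5 _∷⟨_⟩_

  data Walk (E : List Edge) : Vertex → Vertex → Set where
    [_]    : ∀ v → Walk E v v
    _∷⟨_⟩_ : ∀ u → (u , v) ∈ E → Walk E v w → Walk E u w

  verts : Walk E u w → List Vertex
  verts [ v ]          = v ∷ []
  verts (u ∷⟨ _ ⟩ p) = u ∷ verts p

  start∈verts : (p : Walk E u w) → u ∈ verts p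
  start∈verts [ _ ]         = here refl
  start∈verts (_ ∷⟨ _ ⟩ _) = here refl

  end∈verts : (p : Walk E u w) → w ∈ verts p
  end∈verts [ _ ]         = here refl
  end∈verts (_ ∷⟨ _ ⟩ p) = there (end∈verts p)

  _++⟨_⟩_ : Walk E a v → v ≡ w → Walk E w b → Walk E a b
  [ _ ]          ++⟨ refl ⟩ r = r
  (u ∷⟨ e ⟩ p) ++⟨ eq   ⟩ r = u ∷⟨ e ⟩ (p ++⟨ eq ⟩ r)

  ∈-++⁻ : (p : Walk E a v) (eq : v ≡ w) (r : Walk E w b) →
          z ∈ verts (p ++⟨ eq ⟩ r) → z ∈ verts p ⊎ z ∈ verts r
  ∈-++⁻ [ _ ]          refl r z∈          = inj₂ z∈
  ∈-++⁻ (_ ∷⟨ _ ⟩ p) eq   r (here z≡)  = inj₁ (here z≡)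
  ∈-++⁻ (_ ∷⟨ _ ⟩ p) eq   r (there z∈) with ∈-++⁻ p eq r z∈
  ... | inj₁ z∈p = inj₁ (there z∈p)
  ... | inj₂ z∈r = inj₂ z∈r

  prefix : (p : Walk E a b) → w ∈ verts p → Σ (Walk E a w) λ q → verts q ⊆ verts p
  prefix [ v ]          (here refl) = [ v ] , λ z∈ → z∈
  prefix (u ∷⟨ e ⟩ p) (here refl) = [ u ] , ∷⁺ʳ u λ ()
  prefix (u ∷⟨ e ⟩ p) (there w∈) with q , q⊆p ← prefix p w∈ = u ∷⟨ e ⟩ q , ∷⁺ʳ u q⊆p

  suffix : (p : Walk E a b) → w ∈ verts p → Σ (Walk E w b) λ r → verts r ⊆ verts p
  suffix [ v ]          (here refl) = [ v ] , λ z∈ → z∈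
  suffix (u ∷⟨ e ⟩ p) (here refl) = u ∷⟨ e ⟩ p , λ z∈ → z∈
  suffix (u ∷⟨ e ⟩ p) (there w∈) with r , r⊆p ← suffix p w∈ = r , there ∘ r⊆p

  weaken : ∀ {e} → Walk E a b → Walk (e ∷ E) a b
  weaken [ v ]          = [ v ]
  weaken (u ∷⟨ e ⟩ p) = u ∷⟨ there e ⟩ weaken p

  verts-weaken : ∀ {e} (p : Walk E a b) → verts (weaken {e = e} p) ≡ verts p
  verts-weaken [ v ]          = refl
  verts-weaken (u ∷⟨ e ⟩ p) = cong (u ∷_) (verts-weaken p)

  ∈-weaken⁻ : ∀ {e} (p : Walk E a b) → z ∈ verts (weaken {e = e} p) → z ∈ verts p
  ∈-weaken⁻ p = subst (_ ∈_) (verts-weaken p)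

  Avoids : List Vertex → Walk E a b → Set
  Avoids S p = ∀ {z} → z ∈ verts p → z ∉ S

  avoids-++ : (p : Walk E a v) (eq : v ≡ w) (r : Walk E w b) →
              Avoids S p → Avoids S r → Avoids S (p ++⟨ eq ⟩ r)
  avoids-++ p eq r p-avoids r-avoids z∈ with ∈-++⁻ p eq r z∈
  ... | inj₁ z∈p = p-avoids z∈p
  ... | inj₂ z∈r = r-avoids z∈r

  record ABWalk (E : List Edge) (A B : VertexSet) : Set where
    constructor abWalk
    field
      {start end} : Vertex
      start∈A : A start
      end∈B   : B end
      walk    : Walk E start end
  open ABWalk public

  vertsᴬᴮ : ABWalk E A B → List Vertex
  vertsᴬᴮ R = verts (walk R)

  weakenᴬᴮ : ∀ {e} → ABWalk E A B → ABWalk (e ∷ E) A B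
  weakenᴬᴮ R = abWalk (start∈A R) (end∈B R) (weaken (walk R))

  Disjoint : ∀ {k} → (Fin k → ABWalk E A B) → Set
  Disjoint P = ∀ i j → i ≢ j → ∀ v → v ∈ vertsᴬᴮ (P i) → v ∈ vertsᴬᴮ (P j) → ⊥

  disjoint-⊆ : ∀ {k} (P : Fin k → ABWalk E A B) (P′ : Fin k → ABWalk E′ A′ B′) →
               Disjoint P → (∀ i → vertsᴬᴮ (P′ i) ⊆ vertsᴬᴮ (P i)) → Disjoint P′
  disjoint-⊆ _ _ P-disj P′⊆P i j i≢j v v∈i v∈j = P-disj i j i≢j v (P′⊆P i v∈i) (P′⊆P j v∈j)

  disjoint⇒ends-injective : ∀ {k} (P : Fin k → ABWalk E A B) → Disjoint P → Injective _≡_ _≡_ (end ∘ P)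
  disjoint⇒ends-injective P P-disj {i} {j} eq with i Fin.≟ j
  ... | yes i≡j = i≡j
  ... | no  i≢j = ⊥-elim (P-disj i j i≢j _ (end∈verts (walk (P i)))
                                           (subst (_∈ vertsᴬᴮ (P j)) (sym eq) (end∈verts (walk (P j)))))

  disjoint⇒starts-injective : ∀ {k} (P : Fin k → ABWalk E A B) → Disjoint P → Injective _≡_ _≡_ (start ∘ P)
  disjoint⇒starts-injective P P-disj {i} {j} eq with i Fin.≟ j
  ... | yes i≡j = i≡j
  ... | no  i≢j = ⊥-elim (P-disj i j i≢j _ (start∈verts (walk (P i)))
                                           (subst (_∈ vertsᴬᴮ (P j)) (sym eq) (start∈verts (walk (P j)))))

  Linkage : List Edge → VertexSet → VertexSet → ℕ → Set
  Linkage E A B k = Σ (Fin k → ABWalk E A B) Disjoint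

  weaken-linkage : ∀ {e k} → Linkage E A B k → Linkage (e ∷ E) A B k
  weaken-linkage (P , P-disj) = P′ , disjoint-⊆ P P′ P-disj (λ i → ∈-weaken⁻ (walk (P i)))
    where
      P′ : Fin _ → ABWalk _ _ _
      P′ i = weakenᴬᴮ (P i)

  Separator : List Edge → VertexSet → VertexSet → List Vertex → Set
  Separator E A B S = ∀ (R : ABWalk E A B) → ∃ λ w → w ∈ S × w ∈ vertsᴬᴮ R

  separator-meets : Separator E A B S → A a → B b → (p : Walk E a b) → Avoids S p → ⊥
  separator-meets sep a∈A b∈B p p-avoids with _ , w∈S , w∈p ← sep (abWalk a∈A b∈B p) = p-avoids w∈p w∈S

  MeetsOnlyAtEnd : List Vertex → Walk E a b → Set
  MeetsOnlyAtEnd T [ _ ]          = ⊤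
  MeetsOnlyAtEnd T (u ∷⟨ _ ⟩ p) = u ∉ T × MeetsOnlyAtEnd T p

  MeetsOnlyAtStart : List Vertex → Walk E a b → Set
  MeetsOnlyAtStart T [ _ ]          = ⊤
  MeetsOnlyAtStart T (_ ∷⟨ _ ⟩ p) = Avoids T p

  meetsOnlyAtEnd-end : (p : Walk E a b) → MeetsOnlyAtEnd T p → z ∈ verts p → z ∈ T → z ≡ b
  meetsOnlyAtEnd-end [ _ ]          _            (here refl) _   = refl
  meetsOnlyAtEnd-end (_ ∷⟨ _ ⟩ _) (u∉T , _)    (here refl) z∈T = ⊥-elim (u∉T z∈T)
  meetsOnlyAtEnd-end (_ ∷⟨ _ ⟩ p) (_ , p-once) (there z∈)  z∈T = meetsOnlyAtEnd-end p p-once z∈ z∈T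

  meetsOnlyAtStart-start : (p : Walk E a b) → MeetsOnlyAtStart T p → z ∈ verts p → z ∈ T → z ≡ a
  meetsOnlyAtStart-start [ _ ]          _        (here refl) _   = refl
  meetsOnlyAtStart-start (_ ∷⟨ _ ⟩ _) _        (here refl) _   = refl
  meetsOnlyAtStart-start (_ ∷⟨ _ ⟩ _) p-avoids (there z∈)  z∈T = ⊥-elim (p-avoids z∈ z∈T)

  meetsOnlyAtEnd-prefix : S ⊆ T → (p : Walk E a b) → MeetsOnlyAtEnd T p →
                          w ∈ verts p → w ∉ S → Σ (Walk E a w) (Avoids S)
  meetsOnlyAtEnd-prefix S⊆T [ v ]          _              (here refl) w∉S = [ v ] , λ { (here refl) → w∉S }
  meetsOnlyAtEnd-prefix S⊆T (u ∷⟨ e ⟩ p) _              (here refl) w∉S = [ u ] , λ { (here refl) → w∉S }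
  meetsOnlyAtEnd-prefix S⊆T (u ∷⟨ e ⟩ p) (u∉T , p-once) (there w∈)  w∉S
    with q , q-avoids ← meetsOnlyAtEnd-prefix S⊆T p p-once w∈ w∉S =
    u ∷⟨ e ⟩ q , λ { (here refl) → u∉T ∘ S⊆T ; (there z∈) → q-avoids z∈ }

  meetsOnlyAtStart-suffix : S ⊆ T → (p : Walk E a b) → MeetsOnlyAtStart T p →
                            w ∈ verts p → w ∉ S → Σ (Walk E w b) (Avoids S)
  meetsOnlyAtStart-suffix S⊆T [ v ]          _        (here refl) w∉S = [ v ] , λ { (here refl) → w∉S }
  meetsOnlyAtStart-suffix S⊆T (u ∷⟨ e ⟩ p) p-avoids (here refl) w∉S =
    u ∷⟨ e ⟩ p , λ { (here refl) → w∉S ; (there z∈) → p-avoids z∈ ∘ S⊆T }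
  meetsOnlyAtStart-suffix S⊆T (u ∷⟨ e ⟩ p) p-avoids (there w∈)  w∉S
    with r , r⊆p ← suffix p w∈ = r , λ z∈ → p-avoids (r⊆p z∈) ∘ S⊆T

  untilFirstHit : (p : Walk E a b) → b ∈ T →
                  ∃ λ b′ → b′ ∈ T × Σ (Walk E a b′) λ q → verts q ⊆ verts p × MeetsOnlyAtEnd T q
  untilFirstHit [ v ] v∈T = v , v∈T , [ v ] , id , tt
  untilFirstHit {T = T} (u ∷⟨ e ⟩ p) b∈T with u ∈? T
  ... | yes u∈T = u , u∈T , [ u ] , ∷⁺ʳ u (λ ()) , tt
  ... | no  u∉T with b′ , b′∈T , q , q⊆p , q-once ← untilFirstHit p b∈T =
    b′ , b′∈T , u ∷⟨ e ⟩ q , ∷⁺ʳ u q⊆p , u∉T , q-once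

  fromLastHit : (p : Walk E a b) → Avoids T p ⊎
                ∃ λ a′ → a′ ∈ T × Σ (Walk E a′ b) λ r → verts r ⊆ verts p × MeetsOnlyAtStart T r
  fromLastHit {T = T} [ v ] with v ∈? T
  ... | yes v∈T = inj₂ (v , v∈T , [ v ] , id , tt)
  ... | no  v∉T = inj₁ λ { (here refl) → v∉T }
  fromLastHit {T = T} (u ∷⟨ e ⟩ p) with fromLastHit p
  ... | inj₂ (a′ , a′∈T , r , r⊆p , r-once) = inj₂ (a′ , a′∈T , r , there ∘ r⊆p , r-once)
  ... | inj₁ p-avoids with u ∈? T
  ...   | yes u∈T = inj₂ (u , u∈T , u ∷⟨ e ⟩ p , id , p-avoids)
  ...   | no  u∉T = inj₁ λ { (here refl) → u∉T ; (there z∈) → p-avoids z∈ }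

  shrinkLinkage : ∀ {k} {Good : ABWalk E A′ B′ → Set} →
                  (∀ R → Σ (ABWalk E A′ B′) λ R′ → vertsᴬᴮ R′ ⊆ vertsᴬᴮ R × Good R′) →
                  Linkage E A B k → Σ (Linkage E A′ B′ k) λ (P′ , _) → ∀ i → Good (P′ i)
  shrinkLinkage shrink (P , P-disj) =
    (P′ , disjoint-⊆ P P′ P-disj (proj₁ ∘ proj₂ ∘ shrink ∘ P)) , proj₂ ∘ proj₂ ∘ shrink ∘ P
    where
      P′ : Fin _ → ABWalk _ _ _
      P′ = proj₁ ∘ shrink ∘ P

  LinkageInto : List Edge → VertexSet → List Vertex → ℕ → Set
  LinkageInto E A T k = Σ (Linkage E A (_∈ T) k) λ (P , _) → ∀ i → MeetsOnlyAtEnd T (walk (P i))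

  LinkageOutOf : List Edge → List Vertex → VertexSet → ℕ → Set
  LinkageOutOf E T B k = Σ (Linkage E (_∈ T) B k) λ (Q , _) → ∀ j → MeetsOnlyAtStart T (walk (Q j))

  trimEnd : (R : ABWalk E A (_∈ T)) →
            Σ (ABWalk E A (_∈ T)) λ R′ → vertsᴬᴮ R′ ⊆ vertsᴬᴮ R × MeetsOnlyAtEnd T (walk R′)
  trimEnd R with b′ , b′∈T , q , q⊆p , q-once ← untilFirstHit (walk R) (end∈B R) =
    abWalk (start∈A R) b′∈T q , q⊆p , q-once

  trimStart : (R : ABWalk E (_∈ T) B) →
              Σ (ABWalk E (_∈ T) B) λ R′ → vertsᴬᴮ R′ ⊆ vertsᴬᴮ R × MeetsOnlyAtStart T (walk R′)
  trimStart R with fromLastHit (walk R)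
  ... | inj₁ p-avoids = ⊥-elim (p-avoids (start∈verts (walk R)) (start∈A R))
  ... | inj₂ (a′ , a′∈T , r , r⊆p , r-once) = abWalk a′∈T (end∈B R) r , r⊆p , r-once

  trimEnds : ∀ {k} → Linkage E A (_∈ T) k → LinkageInto E A T k
  trimEnds = shrinkLinkage trimEnd

  trimStarts : ∀ {k} → Linkage E (_∈ T) B k → LinkageOutOf E T B k
  trimStarts = shrinkLinkage trimStart

  module NewEdge {x y : Vertex} {E : List Edge} where

    G : List Edge
    G = (x , y) ∷ E

    untilNewEdge : (p : Walk G a b) →
                   (Σ (Walk E a b) λ p′ → verts p′ ⊆ verts p) ⊎ (Σ (Walk E a x) λ q → verts q ⊆ verts p)
    untilNewEdge [ v ]                  = inj₁ ([ v ] , id)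
    untilNewEdge (u ∷⟨ here refl ⟩ p) = inj₂ ([ u ] , ∷⁺ʳ u λ ())
    untilNewEdge (u ∷⟨ there e ⟩ p) with untilNewEdge p
    ... | inj₁ (p′ , p′⊆p) = inj₁ (u ∷⟨ e ⟩ p′ , ∷⁺ʳ u p′⊆p)
    ... | inj₂ (q , q⊆p)   = inj₂ (u ∷⟨ e ⟩ q , ∷⁺ʳ u q⊆p)

    afterNewEdge : (p : Walk G a b) →
                   (Σ (Walk E a b) λ p′ → verts p′ ⊆ verts p) ⊎ (Σ (Walk E y b) λ r → verts r ⊆ verts p)
    afterNewEdge [ v ] = inj₁ ([ v ] , id)
    afterNewEdge (u ∷⟨ e ⟩ p) with afterNewEdge p | e
    ... | inj₂ (r , r⊆p)   | _         = inj₂ (r , there ∘ r⊆p)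
    ... | inj₁ (p′ , p′⊆p) | here refl = inj₂ (p′ , there ∘ p′⊆p)
    ... | inj₁ (p′ , p′⊆p) | there e′  = inj₁ (u ∷⟨ e′ ⟩ p′ , ∷⁺ʳ u p′⊆p)

    module _ (sepS : Separator E A B S) where

      separator-∷ : Separator G A B (x ∷ S)
      separator-∷ R with untilNewEdge (walk R)
      ... | inj₂ (q , q⊆p) = x , here refl , q⊆p (end∈verts q)
      ... | inj₁ (p′ , p′⊆p) with w , w∈S , w∈p′ ← sepS (abWalk (start∈A R) (end∈B R) p′) =
        w , there w∈S , p′⊆p w∈p′

      separator-viaTail : Separator E A (_∈ x ∷ S) U → Separator G A B U
      separator-viaTail sepU R with untilNewEdge (walk R)
      ... | inj₂ (q , q⊆p) with u , u∈U , u∈q ← sepU (abWalk (start∈A R) (here refl) q) =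
        u , u∈U , q⊆p u∈q
      ... | inj₁ (p′ , p′⊆p)
        with w , w∈S , w∈p′ ← sepS (abWalk (start∈A R) (end∈B R) p′)
        with q , q⊆p′ ← prefix p′ w∈p′
        with u , u∈U , u∈q ← sepU (abWalk (start∈A R) (there w∈S) q) =
        u , u∈U , p′⊆p (q⊆p′ u∈q)

      separator-viaHead : Separator E (_∈ y ∷ S) B U → Separator G A B U
      separator-viaHead sepU R with afterNewEdge (walk R)
      ... | inj₂ (r , r⊆p) with u , u∈U , u∈r ← sepU (abWalk (here refl) (end∈B R) r) =
        u , u∈U , r⊆p u∈r
      ... | inj₁ (p′ , p′⊆p)
        with w , w∈S , w∈p′ ← sepS (abWalk (start∈A R) (end∈B R) p′)
        with r , r⊆p′ ← suffix p′ w∈p′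
        with u , u∈U , u∈r ← sepU (abWalk (there w∈S) (end∈B R) r) =
        u , u∈U , p′⊆p (r⊆p′ u∈r)

      module Glue (LP : LinkageInto E A (x ∷ S) (suc (length S)))
                  (LQ : LinkageOutOf E (y ∷ S) B (suc (length S))) where

        open ≡-Reasoning

        private
          k : ℕ
          k = suc (length S)

          P : Fin k → ABWalk E A (_∈ x ∷ S)
          P = proj₁ (proj₁ LP)

          Q : Fin k → ABWalk E (_∈ y ∷ S) B
          Q = proj₁ (proj₁ LQ)

          P-disj : Disjoint P
          P-disj = proj₂ (proj₁ LP)

          Q-disj : Disjoint Q
          Q-disj = proj₂ (proj₁ LQ)

        ends-injective : Injective _≡_ _≡_ (end ∘ P)
        ends-injective = disjoint⇒ends-injective P P-disj

        starts-injective : Injective _≡_ _≡_ (start ∘ Q)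
        starts-injective = disjoint⇒starts-injective Q Q-disj

        y∉S : y ∉ S
        y∉S y∈S = ℕ.1+n≰n (injection⇒≤length starts-injective λ j → starts∈S (start∈A (Q j)))
          where
            starts∈S : z ∈ y ∷ S → z ∈ S
            starts∈S (here refl) = y∈S
            starts∈S (there z∈S) = z∈S

        starts-onto : z ∈ y ∷ S → ∃ λ j → start (Q j) ≡ z
        starts-onto {z} z∈ with Fin.any? (λ j → start (Q j) Fin.≟ z)
        ... | yes found = found
        ... | no  none  = ⊥-elim (ℕ.<-irrefl refl
                (injection-missing⇒<length starts-injective (start∈A ∘ Q) z∈ (λ j eq → none (j , eq))))

        -- The Q-walk continuing the P-walk that ends at w starts at relay w; the new edge carries x to y.
        relay : Vertex → Vertex
        relay w with w Fin.≟ x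
        ... | yes _ = y
        ... | no  _ = w

        relay-∈ : w ∈ x ∷ S → relay w ∈ y ∷ S
        relay-∈ {w} w∈ with w Fin.≟ x
        ... | yes _   = here refl
        ... | no  w≢x = there (Any.tail w≢x w∈)

        relay-injective : a ∈ x ∷ S → b ∈ x ∷ S → relay a ≡ relay b → a ≡ b
        relay-injective {a} {b} a∈ b∈ eq with a Fin.≟ x | b Fin.≟ x
        ... | yes a≡x | yes b≡x = trans a≡x (sym b≡x)
        ... | yes _   | no  b≢x = ⊥-elim (y∉S (subst (_∈ S) (sym eq) (Any.tail b≢x b∈)))
        ... | no  a≢x | yes _   = ⊥-elim (y∉S (subst (_∈ S) eq (Any.tail a≢x a∈)))
        ... | no  _   | no  _   = eq

        relay-fixed : a ∈ x ∷ S → relay a ∈ x ∷ S → relay a ≡ a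
        relay-fixed {a} a∈ ra∈ with a Fin.≟ x
        ... | no  _   = refl
        ... | yes a≡x with ra∈
        ...   | here y≡x  = trans y≡x (sym a≡x)
        ...   | there y∈S = ⊥-elim (y∉S y∈S)

        bridge : ∀ w → Walk G w (relay w)
        bridge w with w Fin.≟ x
        ... | yes refl = x ∷⟨ here refl ⟩ [ y ]
        ... | no  _    = [ w ]

        ∈-bridge⁻ : ∀ w → z ∈ verts (bridge w) → z ≡ w ⊎ z ≡ relay w
        ∈-bridge⁻ w z∈ with w Fin.≟ x | z∈
        ... | yes refl | here z≡x          = inj₁ z≡x
        ... | yes refl | there (here z≡y) = inj₂ z≡y
        ... | no  _    | here z≡w          = inj₁ z≡w

        partner : Fin k → Fin k
        partner i = proj₁ (starts-onto (relay-∈ (end∈B (P i))))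

        start-partner : ∀ i → start (Q (partner i)) ≡ relay (end (P i))
        start-partner i = proj₂ (starts-onto (relay-∈ (end∈B (P i))))

        partner-injective : Injective _≡_ _≡_ partner
        partner-injective {i} {i′} eq = ends-injective (relay-injective (end∈B (P i)) (end∈B (P i′)) (begin
          relay (end (P i))         ≡⟨ start-partner i ⟨
          start (Q (partner i))     ≡⟨ cong (start ∘ Q) eq ⟩
          start (Q (partner i′))    ≡⟨ start-partner i′ ⟩
          relay (end (P i′))        ∎))

        end≡start-partner⇒≡ : ∀ i i′ → end (P i) ≡ start (Q (partner i′)) → i ≡ i′
        end≡start-partner⇒≡ i i′ eq = ends-injective (trans eq′ (relay-fixed (end∈B (P i′)) relay∈))
          where
            eq′ : end (P i) ≡ relay (end (P i′))
            eq′ = trans eq (start-partner i′)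
            relay∈ : relay (end (P i′)) ∈ x ∷ S
            relay∈ = subst (_∈ x ∷ S) eq′ (end∈B (P i))

        -- A shared vertex off S would splice into an A–B walk of E avoiding S.
        meet : ∀ i j → z ∈ vertsᴬᴮ (P i) → z ∈ vertsᴬᴮ (Q j) → end (P i) ≡ start (Q j)
        meet {z} i j z∈P z∈Q with z ∈? S
        ... | yes z∈S = trans (sym (meetsOnlyAtEnd-end (walk (P i)) (proj₂ LP i) z∈P (there z∈S)))
                              (meetsOnlyAtStart-start (walk (Q j)) (proj₂ LQ j) z∈Q (there z∈S))
        ... | no  z∉S
          with q , q-avoids ← meetsOnlyAtEnd-prefix there (walk (P i)) (proj₂ LP i) z∈P z∉S
          with r , r-avoids ← meetsOnlyAtStart-suffix there (walk (Q j)) (proj₂ LQ j) z∈Q z∉S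
          = ⊥-elim (separator-meets sepS (start∈A (P i)) (end∈B (Q j)) (q ++⟨ refl ⟩ r)
                                    (avoids-++ q refl r q-avoids r-avoids))

        glued : Fin k → ABWalk G A B
        glued i = abWalk (start∈A (P i)) (end∈B (Q (partner i)))
          (weaken (walk (P i)) ++⟨ refl ⟩
           (bridge (end (P i)) ++⟨ sym (start-partner i) ⟩ weaken (walk (Q (partner i)))))

        ∈-glued⁻ : ∀ i → z ∈ vertsᴬᴮ (glued i) →
                   z ∈ vertsᴬᴮ (P i) ⊎ z ∈ vertsᴬᴮ (Q (partner i))
        ∈-glued⁻ i z∈ with ∈-++⁻ (weaken (walk (P i))) refl _ z∈
        ... | inj₁ z∈P = inj₁ (∈-weaken⁻ (walk (P i)) z∈P)
        ... | inj₂ z∈rest with ∈-++⁻ (bridge (end (P i))) (sym (start-partner i)) _ z∈rest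
        ...   | inj₂ z∈Q = inj₂ (∈-weaken⁻ (walk (Q (partner i))) z∈Q)
        ...   | inj₁ z∈bridge with ∈-bridge⁻ (end (P i)) z∈bridge
        ...     | inj₁ refl = inj₁ (end∈verts (walk (P i)))
        ...     | inj₂ refl = inj₂ (subst (_∈ vertsᴬᴮ (Q (partner i))) (start-partner i)
                                         (start∈verts (walk (Q (partner i)))))

        linkage : Linkage G A B k
        linkage = glued , disjoint
          where
            disjoint : Disjoint glued
            disjoint i i′ i≢i′ z z∈i z∈i′ with ∈-glued⁻ i z∈i | ∈-glued⁻ i′ z∈i′
            ... | inj₁ z∈P | inj₁ z∈P′ = P-disj i i′ i≢i′ z z∈P z∈P′
            ... | inj₂ z∈Q | inj₂ z∈Q′ =
              Q-disj (partner i) (partner i′) (i≢i′ ∘ partner-injective) z z∈Q z∈Q′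
            ... | inj₁ z∈P | inj₂ z∈Q′ =
              i≢i′ (end≡start-partner⇒≡ i i′ (meet i (partner i′) z∈P z∈Q′))
            ... | inj₂ z∈Q | inj₁ z∈P′ =
              i≢i′ (sym (end≡start-partner⇒≡ i′ i (meet i′ (partner i) z∈P′ z∈Q)))

  module _ {A B : VertexSet} (A? : Decidable A) (B? : Decidable B) where

    commonVertices : List Vertex
    commonVertices = filter (λ v → A? v ×-dec B? v) (allFin N)

    edgeless-linkage : ∀ {k} → k ≤ length commonVertices → Linkage [] A B k
    edgeless-linkage k≤
      with f , f-inj , f∈ ← unique⇒distinctMembers (Unique.filter⁺ _ (Unique.allFin⁺ N)) k≤ =
      trivial , λ { i j i≢j v (here refl) (here v≡fj) → i≢j (f-inj v≡fj) }
      where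
        trivial : Fin _ → ABWalk [] A B
        trivial i with _ , f∈A , f∈B ← ∈-filter⁻ (λ v → A? v ×-dec B? v) {xs = allFin N} (f∈ i) =
          abWalk f∈A f∈B [ f i ]

    edgeless-separator : Separator [] A B commonVertices
    edgeless-separator (abWalk v∈A v∈B [ v ]) =
      v , ∈-filter⁺ (λ v → A? v ×-dec B? v) (∈-allFin v) (v∈A , v∈B) , here refl

  open NewEdge using (separator-∷; separator-viaTail; separator-viaHead; module Glue)

  menger : ∀ E k {A B : VertexSet} → Decidable A → Decidable B →
           Linkage E A B k ⊎ ∃ λ S → length S < k × Separator E A B S
  menger [] k A? B? with k ≤? length (commonVertices A? B?)
  ... | yes k≤ = inj₁ (edgeless-linkage A? B? k≤)
  ... | no  k≰ = inj₂ (_ , ℕ.≰⇒> k≰ , edgeless-separator A? B?)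
  menger ((x , y) ∷ E) k A? B? with menger E k A? B?
  ... | inj₁ L = inj₁ (weaken-linkage L)
  ... | inj₂ (S , |S|<k , sepS) with suc (length S) <? k
  ...   | yes |x∷S|<k = inj₂ (x ∷ S , |x∷S|<k , separator-∷ sepS)
  ...   | no  |x∷S|≮k with menger E k A? (_∈? x ∷ S) | menger E k (_∈? y ∷ S) B?
  ...     | inj₂ (U , |U|<k , sepU) | _ = inj₂ (U , |U|<k , separator-viaTail sepS sepU)
  ...     | inj₁ _ | inj₂ (U , |U|<k , sepU) = inj₂ (U , |U|<k , separator-viaHead sepS sepU)
  ...     | inj₁ LP | inj₁ LQ with refl ← ℕ.≤-antisym (ℕ.≮⇒≥ |x∷S|≮k) |S|<k =
    inj₁ (Glue.linkage sepS (trimEnds LP) (trimStarts LQ))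

module AdjacencyWalks {N : ℕ} (adj : Fin N → Fin N → Bool) where
  open Menger N public

  private variable
    E       : List Edge
    a u w z : Vertex
    d       : ℕ

  private
    isEdge? : Decidable λ ((u , v) : Edge) → adj u v ≡ true
    isEdge? (u , v) = adj u v Bool.≟ true

    allPairs : List Edge
    allPairs = cartesianProduct (allFin N) (allFin N)

  edges : List Edge
  edges = filter isEdge? allPairs

  ∈-edges⁻ : (u , w) ∈ edges → adj u w ≡ true
  ∈-edges⁻ e = proj₂ (∈-filter⁻ isEdge? {xs = allPairs} e)

  ∈-edges⁺ : adj u w ≡ true → (u , w) ∈ edges
  ∈-edges⁺ {u} {w} = ∈-filter⁺ isEdge? (∈-cartesianProduct⁺ (∈-allFin u) (∈-allFin w))

  toPath : Walk edges u w → Path adj u w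
  toPath [ v ]          = [ v ]
  toPath (u ∷⟨ e ⟩ p) = u ∷⟨ ∈-edges⁻ e ⟩ toPath p

  vertices-toPath : (p : Walk edges u w) → vertices adj (toPath p) ≡ verts p
  vertices-toPath [ v ]          = refl
  vertices-toPath (u ∷⟨ e ⟩ p) = cong (u ∷_) (vertices-toPath p)

  snoc : Walk E a u → (u , w) ∈ E → Walk E a w
  snoc [ u ]           e = u ∷⟨ e ⟩ [ _ ]
  snoc (v ∷⟨ e′ ⟩ p) e = v ∷⟨ e′ ⟩ snoc p e

  length-snoc : (p : Walk E a u) (e : (u , w) ∈ E) → length (verts (snoc p e)) ≡ suc (length (verts p))
  length-snoc [ u ]           e = refl
  length-snoc (v ∷⟨ e′ ⟩ p) e = cong suc (length-snoc p e)

  ∈-snoc⁻ : (p : Walk E a u) (e : (u , w) ∈ E) → z ∈ verts (snoc p e) → z ∈ verts p ⊎ z ≡ w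
  ∈-snoc⁻ [ u ]           e (here z≡u)          = inj₁ (here z≡u)
  ∈-snoc⁻ [ u ]           e (there (here z≡w)) = inj₂ z≡w
  ∈-snoc⁻ (v ∷⟨ e′ ⟩ p) e (here z≡v)          = inj₁ (here z≡v)
  ∈-snoc⁻ (v ∷⟨ e′ ⟩ p) e (there z∈) with ∈-snoc⁻ p e z∈
  ... | inj₁ z∈p = inj₁ (there z∈p)
  ... | inj₂ z≡w = inj₂ z≡w

  verts-unique : Acyclic adj → (p : Walk edges u w) → Unique (verts p)
  verts-unique acyclic [ v ]          = [] ∷ []
  verts-unique acyclic (u ∷⟨ e ⟩ p) = tabulate u∉p ∷ verts-unique acyclic p
    where
      u∉p : ∀ {z} → z ∈ verts p → u ≢ z
      u∉p z∈ refl = acyclic _ _ (∈-edges⁻ e) (toPath (proj₁ (prefix p z∈)))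

  Depth≤ : ℕ → Vertex → Set
  Depth≤ d w = ∀ {s} (p : Walk edges s w) → length (verts p) ≤ d

  depth≤N : Acyclic adj → Depth≤ N w
  depth≤N acyclic p = unique⇒length≤ (verts-unique acyclic p)

  ¬depth≤0 : ¬ Depth≤ 0 w
  ¬depth≤0 w-depth with () ← w-depth [ _ ]

  depth≤-pred : Depth≤ (suc d) w → adj u w ≡ true → Depth≤ d u
  depth≤-pred w-depth e p =
    ℕ.≤-pred (subst (_≤ _) (length-snoc p (∈-edges⁺ e)) (w-depth (snoc p (∈-edges⁺ e))))

module DAGLinkages {n m : ℕ} (G : DAG n m) where
  open DAG G
  open AdjacencyWalks adj public

  IsInputIn : Subset n → VertexSet
  IsInputIn X v = ∃ λ a → a ∈ₛ X × inp a ≡ v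

  isInputIn? : ∀ X → Decidable (IsInputIn X)
  isInputIn? X v = Fin.any? λ a → (a Subset.∈? X) ×-dec (inp a Fin.≟ v)

  IsOutputIn : Subset m → VertexSet
  IsOutputIn Y v = ∃ λ b → b ∈ₛ Y × out b ≡ v

  isOutputIn? : ∀ Y → Decidable (IsOutputIn Y)
  isOutputIn? Y v = Fin.any? λ b → (b Subset.∈? Y) ×-dec (out b Fin.≟ v)

  module _ {X : Subset n} {Y : Subset m} where

    toPathXY : ABWalk edges (IsInputIn X) (IsOutputIn Y) → PathXY G X Y
    toPathXY (abWalk (a , a∈X , refl) (b , b∈Y , refl) p) =
      record { a = a ; a∈X = a∈X ; b = b ; b∈Y = b∈Y ; path = toPath p }

    pathVerts-toPathXY : ∀ R → pathVerts G (toPathXY R) ≡ vertsᴬᴮ R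
    pathVerts-toPathXY (abWalk (_ , _ , refl) (_ , _ , refl) p) = vertices-toPath p

    linkage⇒disjointPaths : ∀ {k} → Linkage edges (IsInputIn X) (IsOutputIn Y) k → DisjointPaths G X Y k
    linkage⇒disjointPaths (P , P-disj) = toPathXY ∘ P , λ i j i≢j v v∈i v∈j →
      P-disj i j i≢j v (subst (v ∈_) (pathVerts-toPathXY (P i)) v∈i)
                       (subst (v ∈_) (pathVerts-toPathXY (P j)) v∈j)

module Evaluation {𝔽 : FiniteField} {n m : ℕ} (Φ : Circuit 𝔽 n m) where
  open FiniteField 𝔽 using (Carrier; 0#; 0≢1; enum)
  open Circuit Φ
  open DAG graph
  open DAGLinkages graph
  open import Data.List.Membership.DecPropositional (Fin._≟_ {N}) using (_∈?_)
  open ≡-Reasoning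

  isInput? : ∀ v → Dec (∃ λ a → inp a ≡ v)
  isInput? v = Fin.any? λ a → inp a Fin.≟ v

  module _ (x : Fin n → Carrier) where

    -- Fuel-bounded evaluation (0# once the fuel runs out): it is exact at vertices of depth at
    -- most the fuel, and acyclicity bounds every depth by N.
    evaluateWithin : ℕ → Vertex → Carrier
    evaluateWithin zero    v = 0#
    evaluateWithin (suc d) v with isInput? v
    ... | yes (a , _) = x a
    ... | no  _       = gate v (evaluateWithin d)

    evaluateWithin-stable : ∀ d d′ v → Depth≤ d v → d ≤ d′ → evaluateWithin d v ≡ evaluateWithin d′ v
    evaluateWithin-stable zero    _        v v-depth _ = ⊥-elim (¬depth≤0 v-depth)
    evaluateWithin-stable (suc d) (suc d′) v v-depth (s≤s d≤d′) with isInput? v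
    ... | yes _ = refl
    ... | no  _ = gate-local v _ _ λ u e → evaluateWithin-stable d d′ u (depth≤-pred v-depth e) d≤d′

    evaluate : Vertex → Carrier
    evaluate = evaluateWithin (suc N)

    evaluate-consistent : Consistent Φ x evaluate
    evaluate-consistent = on-inputs , on-gates
      where
        on-inputs : ∀ a → evaluate (inp a) ≡ x a
        on-inputs a with isInput? (inp a)
        ... | yes (a′ , inp-a′≡inp-a) = cong x (inp-inj inp-a′≡inp-a)
        ... | no  not-input           = ⊥-elim (not-input (a , refl))

        on-gates : ∀ v → (∀ a → inp a ≢ v) → evaluate v ≡ gate v evaluate
        on-gates v not-input with isInput? v
        ... | yes (a , inp-a≡v) = ⊥-elim (not-input a inp-a≡v)
        ... | no  _             = gate-local v _ _ λ u _ →
                evaluateWithin-stable N (suc N) u (depth≤N acyclic) (ℕ.n≤1+n N)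

  Screened : Subset n → List Vertex → Vertex → Set
  Screened X S w = ∀ {s} → IsInputIn X s → (p : Walk edges s w) → ∃ λ z → z ∈ S × z ∈ verts p

  screened-source : ∀ {X S w} → Screened X S w → IsInputIn X w → w ∈ S
  screened-source w-screened w∈X with _ , z∈S , here refl ← w-screened w∈X [ _ ] = z∈S

  separator⇒screened : ∀ {X Y S} → Separator edges (IsInputIn X) (IsOutputIn Y) S →
                       ∀ {b} → b ∈ₛ Y → Screened X S (out b)
  separator⇒screened sepS b∈Y s∈X p = sepS (abWalk s∈X (_ , b∈Y , refl) p)

  module _ {X : Subset n} {S : List Vertex} {x y : Fin n → Carrier} {val val′ : Vertex → Carrier}
           (val-consistent : Consistent Φ x val) (val′-consistent : Consistent Φ y val′)
           (agree-off-X : AgreeOutside X x y) (agree-on-S : ∀ v → v ∈ S → val v ≡ val′ v) where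

    private
      agree-within : ∀ d w → Depth≤ d w → Screened X S w → val w ≡ val′ w
      agree-within zero    w w-depth _ = ⊥-elim (¬depth≤0 w-depth)
      agree-within (suc d) w w-depth w-screened with w ∈? S | isInput? w
      ... | yes w∈S | _ = agree-on-S w w∈S
      ... | no  w∉S | yes (a , refl) with a Subset.∈? X
      ...   | yes a∈X = ⊥-elim (w∉S (screened-source w-screened (a , a∈X , refl)))
      ...   | no  a∉X = begin
        val (inp a)  ≡⟨ proj₁ val-consistent a ⟩
        x a          ≡⟨ agree-off-X a a∉X ⟩
        y a          ≡⟨ proj₁ val′-consistent a ⟨
        val′ (inp a) ∎
      agree-within (suc d) w w-depth w-screened | no w∉S | no not-input = begin
        val w        ≡⟨ proj₂ val-consistent w (λ a → not-input ∘ (a ,_)) ⟩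
        gate w val   ≡⟨ gate-local w val val′ (λ u e →
                          agree-within d u (depth≤-pred w-depth e) (screened-pred e)) ⟩
        gate w val′  ≡⟨ proj₂ val′-consistent w (λ a → not-input ∘ (a ,_)) ⟨
        val′ w       ∎
        where
          screened-pred : ∀ {u} → adj u w ≡ true → Screened X S u
          screened-pred e s∈X p
            with z , z∈S , z∈ ← w-screened s∈X (snoc p (∈-edges⁺ e))
            with ∈-snoc⁻ p (∈-edges⁺ e) z∈
          ... | inj₁ z∈p  = z , z∈S , z∈p
          ... | inj₂ refl = ⊥-elim (w∉S z∈S)

    consistent-agree-screened : ∀ w → Screened X S w → val w ≡ val′ w
    consistent-agree-screened w = agree-within N w (depth≤N acyclic)

  indistinguishable-on-separator : ∀ X S → length S < ∣ X ∣ →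
    ∃ λ x → ∃ λ y → x ≢ y × AgreeOutside X x y × (∀ v → v ∈ S → evaluate x v ≡ evaluate y v)
  indistinguishable-on-separator X S |S|<|X|
    with f , g , f≉g , same-on-S ← functions-pigeonhole enum (distinct⇒1<size enum 0≢1) |S|<|X|
                                     (λ f l → evaluate (extend 0# X f) (lookup S l))
    = extend 0# X f , extend 0# X g , x≢y , agree-off-X , agree-on-S
    where
      x≢y : extend 0# X f ≢ extend 0# X g
      x≢y x≡y = f≉g λ l → trans (sym (restrict-extend 0# X f l))
                           (trans (cong (λ x → restrict X x l) x≡y) (restrict-extend 0# X g l))
      agree-off-X : AgreeOutside X (extend 0# X f) (extend 0# X g)
      agree-off-X a a∉X = trans (extend-∉ 0# X f a∉X) (sym (extend-∉ 0# X g a∉X))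
      agree-on-S : ∀ v → v ∈ S → evaluate (extend 0# X f) v ≡ evaluate (extend 0# X g) v
      agree-on-S v v∈S rewrite lookup-index v∈S = same-on-S (index v∈S)

module _ {𝔽 : FiniteField} {n m : ℕ} (Φ : Circuit 𝔽 n m)
         {C : (Fin n → FiniteField.Carrier 𝔽) → (Fin m → FiniteField.Carrier 𝔽)}
         (C-sc : SCInducedCode 𝔽 C) (Φ-computes : Computes Φ C) where
  open FiniteField 𝔽 using (_≟_)
  open Circuit Φ
  open DAG graph
  open DAGLinkages graph
  open Evaluation Φ

  separator-determines-outputs :
    ∀ {X Y S} → Separator edges (IsInputIn X) (IsOutputIn Y) S → ∀ {x y} → AgreeOutside X x y →
    (∀ v → v ∈ S → evaluate x v ≡ evaluate y v) → AgreeOn Y (C x) (C y)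
  separator-determines-outputs sepS {x} {y} agree-off-X agree-on-S b b∈Y = begin
    C x b                ≡⟨ Φ-computes x _ (evaluate-consistent x) b ⟨
    evaluate x (out b)   ≡⟨ consistent-agree-screened (evaluate-consistent x) (evaluate-consistent y)
                              agree-off-X agree-on-S (out b) (separator⇒screened sepS b∈Y) ⟩
    evaluate y (out b)   ≡⟨ Φ-computes y _ (evaluate-consistent y) b ⟩
    C y b                ∎
    where open ≡-Reasoning

  no-small-separator : ∀ (X : Subset n) (Y : Subset m) → ∣ X ∣ ≡ ∣ Y ∣ → ∀ S → length S < ∣ X ∣ →
                       ¬ Separator edges (IsInputIn X) (IsOutputIn Y) S
  no-small-separator X Y |X|≡|Y| S |S|<|X| sepS
    with x , y , x≢y , agree-off-X , agree-on-S ← indistinguishable-on-separator X S |S|<|X|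
    = ℕ.<-irrefl refl (begin-strict
      m                                     <⟨ C-sc x y x≢y ⟩
      dist _≟_ (C x) (C y) + dist _≟_ x y   ≤⟨ ℕ.+-monoʳ-≤ _ (agreeOutside⇒dist≤∣∣ _≟_ X agree-off-X) ⟩
      dist _≟_ (C x) (C y) + ∣ X ∣          ≡⟨ cong (_ +_) |X|≡|Y| ⟩
      dist _≟_ (C x) (C y) + ∣ Y ∣          ≤⟨ agreeOn⇒dist+∣∣≤ _≟_ Y agree-on-Y ⟩
      m                                     ∎)
    where
      open ℕ.≤-Reasoning
      agree-on-Y : AgreeOn Y (C x) (C y)
      agree-on-Y = separator-determines-outputs sepS agree-off-X agree-on-S

  circuit-graph-isSuperconcentrator : IsSuperconcentrator graph
  circuit-graph-isSuperconcentrator X Y |X|≡|Y| with menger edges ∣ X ∣ (isInputIn? X) (isOutputIn? Y)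
  ... | inj₁ linkage                = linkage⇒disjointPaths linkage
  ... | inj₂ (S , |S|<|X| , sepS) = ⊥-elim (no-small-separator X Y |X|≡|Y| S |S|<|X| sepS)

lemma5p3 : (𝔽 : FiniteField) (n m : ℕ) (Φ : Circuit 𝔽 n m)
           (C : (Fin n → FiniteField.Carrier 𝔽) → (Fin m → FiniteField.Carrier 𝔽)) →
           SCInducedCode 𝔽 C → Computes Φ C →
           IsSuperconcentrator (Circuit.graph Φ)
lemma5p3 𝔽 n m Φ C = circuit-graph-isSuperconcentrator Φ
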